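{- Let $n \geq 1$. Under optimal play, the Sign Game on the path graph $P_n$ is a draw when $n$ is odd, and when $n$ is even Player 2 (the player who moves second) wins, with a final score of $1$ point in their favor.
   Context: The Sign Game on a simple undirected graph $G$: two players, Player P and Player N, alternate turns; the one moving first is called Player 1, the other Player 2 (either of P, N may be Player 1). On a turn a player assigns $+1$ or $-1$ to a vertex of $G$ not yet assigned. Once both endpoints of an edge have been assigned, the edge takes the value of the product of its endpoint values. The game ends when all vertices are assigned, and the score $s(G)$ is the sum of all edge values. Player P wins if $s(G) > 0$, Player N wins if $s(G) < 0$, and the game is a draw if $s(G) = 0$. Optimal play: each player's primary goal is to win and secondary goal is to force a draw; the result is the outcome under optimal play by both. The path graph $P_n$ has vertices $v_1, \dots, v_n$ and edges $(v_i, v_{i+1})$ for $i = 1, \dots, n-1$. "Score of $1$ point in Player 2's favor" means $s = 1$ if Player 2 is Player P and $s = -1$ if Player 2 is Player N. -}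

module Defs where

open import Data.Nat using (ℕ; zero; suc)
open import Data.Fin using (Fin; inject₁) renaming (suc to fsuc)
open import Data.Integer using (ℤ; +_; -[1+_]; _+_; _*_; _⊔_; _⊓_; -_) renaming (+0 to 0ℤ)
open import Data.Integer as ℤ using ()
open import Data.Product using (_×_; _,_)
open import Data.List using (List; []; _∷_; map; foldr; concatMap; filter)
open import Data.List using (allFin) public
open import Data.Maybe using (Maybe; just; nothing; is-nothing)
open import Data.Bool using (Bool; true; false; T)
open import Data.Vec using (Vec; lookup; replicate; _[_]≔_)

-- A simple undirected graph on vertex set Fin n, given by its list of edges
-- (each edge listed once as an unordered pair {i , j}).
Graph : ℕ → Set
Graph n = List (Fin n × Fin n)

-- The path graph P_n : vertices v_1..v_n (here Fin n, 0-indexed),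
-- edges (v_i , v_{i+1}).
pathGraph : (n : ℕ) → Graph n
pathGraph zero    = []
pathGraph (suc m) = map (λ i → inject₁ i , fsuc i) (allFin m)

data Val : Set where
  plus minus : Val

toℤ : Val → ℤ
toℤ plus  = + 1
toℤ minus = -[1+ 0 ]

Assignment : ℕ → Set
Assignment n = Vec (Maybe Val) n

edgeVal : Maybe Val → Maybe Val → ℤ
edgeVal (just x) (just y) = toℤ x * toℤ y
edgeVal _        _        = 0ℤ

score : ∀ {n} → Graph n → Assignment n → ℤ
score G a = foldr (λ { (i , j) acc → edgeVal (lookup a i) (lookup a j) + acc }) 0ℤ G

data Player : Set where
  P N : Player

other : Player → Player
other P = N
other N = P

moves : ∀ {n} → Assignment n → List (Fin n × Val)
moves a = concatMap (λ i → (i , plus) ∷ (i , minus) ∷ [])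
                    (filter (λ i → Data.Bool.Properties.T? (is-nothing (lookup a i))) (allFin _))
  where import Data.Bool.Properties

best : Player → ℤ → List ℤ → ℤ
best P x xs = foldr _⊔_ x xs
best N x xs = foldr _⊓_ x xs

-- Starting from the empty assignment with k = n the fuel is exactly the
-- number of moves of the game, so the play ends precisely when all
-- vertices are assigned.
minimax : ∀ {n} → (ℤ → ℤ) → Graph n → ℕ → Player → Assignment n → ℤ
minimax f G zero    r a = f (score G a)
minimax f G (suc k) r a with moves a
... | []            = f (score G a)
... | (i , v) ∷ ms  =
  best r (minimax f G k (other r) (a [ i ]≔ just v))
         (map (λ { (j , w) → minimax f G k (other r) (a [ j ]≔ just w) }) ms)

empty : ∀ n → Assignment n
empty n = replicate n nothing

sgn : ℤ → ℤ
sgn (+ zero)  = 0ℤ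
sgn (+ suc _) = + 1
sgn -[1+ _ ]  = -[1+ 0 ]

data Result : Set where
  wins : Player → Result
  draw : Result

toResult : ℤ → Result
toResult (+ zero)  = draw
toResult (+ suc _) = wins P
toResult -[1+ _ ]  = wins N

-- Each player only cares whether they win / draw / lose; this is the minimax
-- of the win/draw/loss payoff (+1 P wins, 0 draw, -1 N wins), with P
-- maximising and N minimising.
outcome : ∀ {n} → Graph n → (first : Player) → Result
outcome {n} G first = toResult (minimax sgn G n first (empty n))

optimalScore : ∀ {n} → Graph n → (first : Player) → ℤ
optimalScore {n} G first = minimax (λ s → s) G n first (empty n)

inFavourOf : Player → ℕ → ℤ
inFavourOf P k = + k
inFavourOf N k = - (+ k)

-- On a connected graph a player X can make every move except the opening move of the game
-- gain an edge: while some vertex is assigned and some is free, X plays a free vertex next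
-- to an assigned one, copying its value (X = P) or flipping it (X = N), so that this edge
-- counts +1 for X.  Counting every other edge as -1 for X, the second player on P_n
-- (n - 1 edges, ⌈(n-1)/2⌉ gaining moves) secures 2⌈(n-1)/2⌉ - (n-1) in their favour and the
-- first player (⌊(n-1)/2⌋ gaining moves after the opening) secures 2⌊(n-1)/2⌋ - (n-1):
-- 0 and 0 for odd n, +1 and -1 for even n.  These guarantees meet, which pins down the
-- optimal score; the outcome follows because the monotone map sgn commutes with minimax.

module Submission where

open import Defs
open import Data.Product using (_×_; _,_)
open import Relation.Binary.PropositionalEquality using (_≡_)
open import Data.Integer using (+_)

-- A separate scope: the development uses the _≤_ of ℤ, the statement that of ℕ.
module SignGameOnGraphs where

  open import Data.Nat as ℕ using (ℕ; zero; suc; _*_; _%_; _/_; ⌊_/2⌋; ⌈_/2⌉; z≤n)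
  open import Data.Nat.DivMod using (m≡m%n+[m/n]*n)
  open import Data.Nat.Properties using (suc-injective)
  open import Data.Fin using (Fin; inject₁; _≟_) renaming (zero to fzero; suc to fsuc)
  open import Data.Integer using (ℤ; -[1+_]; _+_; _⊔_; _⊓_; -_; _≤_; -≤+; -≤-; +≤+) renaming (+0 to 0ℤ)
  open import Data.Integer.Properties
    using (≤-refl; ≤-reflexive; ≤-trans; ≤-antisym; +-mono-≤; +-monoˡ-≤; +-assoc; +-identityʳ; +-inverseˡ;
           +-commutativeSemigroup; pos-+; [1+m]⊖[1+n]≡m⊖n; neg-distrib-+; neg-mono-≤; neg-involutive;
           neg-distrib-⊓-⊔; neg-distrib-⊔-⊓; ⊓-glb; i≤j⇒i≤j⊔k; i≤j⇒i≤k⊔j; mono-≤-distrib-⊔; mono-≤-distrib-⊓)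
  open import Algebra.Properties.CommutativeSemigroup +-commutativeSemigroup using (xy∙z≈xz∙y)
  open import Data.Product using (∃; ∃₂; proj₂)
  open import Data.Sum using (_⊎_; inj₁; inj₂; [_,_])
  open import Data.List using ([]; _∷_; map; length; filter; allFin)
  open import Data.List.Properties
    using (length-map; length-tabulate; map-cong; map-∘; foldr-preservesᵒ; foldr-preservesᵇ)
  open import Data.List.Membership.Propositional using (_∈_; lose; find)
  open import Data.List.Membership.Propositional.Properties
    using (∈-map⁺; ∈-allFin; ∈-filter⁺; ∈-filter⁻; ∈-concatMap⁺; ∈-concatMap⁻)
  open import Data.List.Relation.Unary.Any using (Any; here; there; toSum)
  open import Data.List.Relation.Unary.Any.Properties using (map⁺)
  open import Data.List.Relation.Unary.All as All using (All; _∷_)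
  import Data.List.Relation.Unary.All.Properties as All
  open import Data.Bool using (T)
  open import Data.Unit using (tt)
  open import Function using (_∘_; id)
  open import Relation.Binary.Definitions using (Monotonic₁)
  open import Data.Maybe using (Maybe; just; nothing; is-nothing)
  open import Data.Vec using ([]; _∷_; lookup; _[_]≔_)
  open import Data.Vec.Properties using (lookup∘update; lookup∘update′; lookup-replicate)
  open import Relation.Binary.PropositionalEquality using (_≢_; refl; sym; trans; cong; cong₂; subst)
  open import Relation.Nullary using (yes; no)

  private variable
    n : ℕ

  favour : Player → ℤ → ℤ
  favour P s = s
  favour N s = - s

  favour-0 : ∀ X → favour X (+ 0) ≡ + 0
  favour-0 P = refl
  favour-0 N = refl

  favour-+1 : ∀ X → favour X (+ 1) ≡ inFavourOf X 1
  favour-+1 P = refl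
  favour-+1 N = refl

  favour-+ : ∀ X s t → favour X (s + t) ≡ favour X s + favour X t
  favour-+ P s t = refl
  favour-+ N s t = neg-distrib-+ s t

  reply : Player → Val → Val
  reply P v     = v
  reply N plus  = minus
  reply N minus = plus

  -1ℤ : ℤ
  -1ℤ = -[1+ 0 ]

  edgeBound : Player → Maybe Val → Maybe Val → ℤ
  edgeBound X (just x) (just y) = favour X (edgeVal (just x) (just y))
  edgeBound X _        _        = -1ℤ

  edgeBound≤edgeVal : ∀ X x y → edgeBound X x y ≤ favour X (edgeVal x y)
  edgeBound≤edgeVal X (just x) (just y) = ≤-refl
  edgeBound≤edgeVal P nothing  y        = -≤+
  edgeBound≤edgeVal N nothing  y        = -≤+
  edgeBound≤edgeVal P (just x) nothing  = -≤+
  edgeBound≤edgeVal N (just x) nothing  = -≤+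

  -1≤edgeBound : ∀ X x y → -1ℤ ≤ edgeBound X x y
  -1≤edgeBound P (just plus)  (just plus)  = -≤+
  -1≤edgeBound P (just plus)  (just minus) = ≤-refl
  -1≤edgeBound P (just minus) (just plus)  = ≤-refl
  -1≤edgeBound P (just minus) (just minus) = -≤+
  -1≤edgeBound N (just plus)  (just plus)  = ≤-refl
  -1≤edgeBound N (just plus)  (just minus) = -≤+
  -1≤edgeBound N (just minus) (just plus)  = -≤+
  -1≤edgeBound N (just minus) (just minus) = ≤-refl
  -1≤edgeBound X nothing      y            = ≤-refl
  -1≤edgeBound X (just x)     nothing      = ≤-refl

  edgeBound-reply : ∀ X y → edgeBound X (just y) (just (reply X y)) ≡ + 1
  edgeBound-reply P plus  = refl
  edgeBound-reply P minus = refl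
  edgeBound-reply N plus  = refl
  edgeBound-reply N minus = refl

  edgeBound-reply′ : ∀ X y → edgeBound X (just (reply X y)) (just y) ≡ + 1
  edgeBound-reply′ P plus  = refl
  edgeBound-reply′ P minus = refl
  edgeBound-reply′ N plus  = refl
  edgeBound-reply′ N minus = refl

  data _≼_ : Maybe Val → Maybe Val → Set where
    nothing≼ : ∀ {m} → nothing ≼ m
    just≼    : ∀ {x} → just x ≼ just x

  ≼-reflexive : ∀ {m m′} → m ≡ m′ → m ≼ m′
  ≼-reflexive {nothing} refl = nothing≼
  ≼-reflexive {just x}  refl = just≼

  edgeBound-mono : ∀ X {x x′ y y′} → x ≼ x′ → y ≼ y′ → edgeBound X x y ≤ edgeBound X x′ y′
  edgeBound-mono X {x′ = x′} {y′ = y′} nothing≼ _ = -1≤edgeBound X x′ y′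
  edgeBound-mono X {x′ = x′} {y′ = y′} just≼ nothing≼ = -1≤edgeBound X x′ y′
  edgeBound-mono X just≼    just≼    = ≤-refl

  _⊑_ : Assignment n → Assignment n → Set
  a ⊑ b = ∀ i → lookup a i ≼ lookup b i

  ⊑-update : ∀ (a : Assignment n) {q} v → lookup a q ≡ nothing → a ⊑ (a [ q ]≔ just v)
  ⊑-update a {q} v aq i with i ≟ q
  ... | yes refl rewrite aq = nothing≼
  ... | no i≢q = ≼-reflexive (sym (lookup∘update′ i≢q a (just v)))

  -- From X's side, a lower bound on the score of every completion of a.
  bound : Player → Graph n → Assignment n → ℤ
  bound X []            a = 0ℤ
  bound X ((i , j) ∷ G) a = edgeBound X (lookup a i) (lookup a j) + bound X G a

  bound≤favour-score : ∀ X (G : Graph n) a → bound X G a ≤ favour X (score G a)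
  bound≤favour-score P []            a = ≤-refl
  bound≤favour-score N []            a = ≤-refl
  bound≤favour-score X ((i , j) ∷ G) a =
    subst (bound X ((i , j) ∷ G) a ≤_) (sym (favour-+ X _ (score G a)))
      (+-mono-≤ (edgeBound≤edgeVal X (lookup a i) (lookup a j)) (bound≤favour-score X G a))

  bound-mono : ∀ X (G : Graph n) {a b} → a ⊑ b → bound X G a ≤ bound X G b
  bound-mono X []            a⊑b = ≤-refl
  bound-mono X ((i , j) ∷ G) a⊑b = +-mono-≤ (edgeBound-mono X (a⊑b i) (a⊑b j)) (bound-mono X G a⊑b)

  bound-empty : ∀ X (G : Graph n) → bound X G (empty n) ≡ - + length G
  bound-empty X [] = refl
  bound-empty X ((i , j) ∷ G) rewrite lookup-replicate i (nothing {A = Val}) | bound-empty X G =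
    -1+-k (length G)
    where
    -1+-k : ∀ k → -1ℤ + - + k ≡ - + suc k
    -1+-k zero    = refl
    -1+-k (suc k) = refl

  Adjacent : Graph n → Fin n → Fin n → Set
  Adjacent G p q = (p , q) ∈ G ⊎ (q , p) ∈ G

  Gains : Player → Assignment n → Assignment n → Fin n × Fin n → Set
  Gains X a b (i , j) = edgeBound X (lookup a i) (lookup a j) + + 2 ≤ edgeBound X (lookup b i) (lookup b j)

  bound-gain : ∀ X (G : Graph n) {a b} → a ⊑ b → Any (Gains X a b) G → bound X G a + + 2 ≤ bound X G b
  bound-gain X ((i , j) ∷ G) {a} a⊑b (here gain) =
    ≤-trans (≤-reflexive (xy∙z≈xz∙y (edgeBound X (lookup a i) (lookup a j)) (bound X G a) (+ 2)))
            (+-mono-≤ gain (bound-mono X G a⊑b))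
  bound-gain X ((i , j) ∷ G) {a} a⊑b (there gains) =
    ≤-trans (≤-reflexive (+-assoc (edgeBound X (lookup a i) (lookup a j)) (bound X G a) (+ 2)))
            (+-mono-≤ (edgeBound-mono X (a⊑b i) (a⊑b j)) (bound-gain X G a⊑b gains))

  reply-gain : ∀ X (G : Graph n) {a p q y} → Adjacent G p q → lookup a p ≡ just y → lookup a q ≡ nothing →
               bound X G a + + 2 ≤ bound X G (a [ q ]≔ just (reply X y))
  reply-gain X G {a} {p} {q} {y} adj ap aq =
    bound-gain X G (⊑-update a (reply X y) aq) ([ (λ e → lose e forward) , (λ e → lose e backward) ] adj)
    where
    p≢q : p ≢ q
    p≢q refl with trans (sym ap) aq
    ... | ()

    bp : lookup (a [ q ]≔ just (reply X y)) p ≡ just y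
    bp = trans (lookup∘update′ p≢q a _) ap

    bq : lookup (a [ q ]≔ just (reply X y)) q ≡ just (reply X y)
    bq = lookup∘update q a _

    forward : Gains X a (a [ q ]≔ just (reply X y)) (p , q)
    forward rewrite ap | aq | bp | bq = ≤-reflexive (sym (edgeBound-reply X y))

    backward : Gains X a (a [ q ]≔ just (reply X y)) (q , p)
    backward rewrite ap | aq | bp | bq = ≤-reflexive (sym (edgeBound-reply′ X y))

  freeCount : Assignment n → ℕ
  freeCount []            = 0
  freeCount (nothing ∷ a) = suc (freeCount a)
  freeCount (just _ ∷ a)  = freeCount a

  freeCount-update : ∀ (a : Assignment n) {i} v → lookup a i ≡ nothing →
                     freeCount a ≡ suc (freeCount (a [ i ]≔ just v))
  freeCount-update (nothing ∷ a) {fzero}  v _  = refl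
  freeCount-update (nothing ∷ a) {fsuc i} v ai = cong suc (freeCount-update a v ai)
  freeCount-update (just x ∷ a)  {fsuc i} v ai = freeCount-update a v ai

  free-exists : ∀ (a : Assignment n) {k} → freeCount a ≡ suc k → ∃ λ i → lookup a i ≡ nothing
  free-exists (nothing ∷ a) _  = fzero , refl
  free-exists (just x ∷ a)  fc with free-exists a fc
  ... | i , ai = fsuc i , ai

  freeCount-move : ∀ (a : Assignment n) {i k} v → lookup a i ≡ nothing → freeCount a ≡ suc k →
                   freeCount (a [ i ]≔ just v) ≡ k
  freeCount-move a v ai fc = suc-injective (trans (sym (freeCount-update a v ai)) fc)

  freeCount-empty : ∀ n → freeCount (empty n) ≡ n
  freeCount-empty zero    = refl
  freeCount-empty (suc n) = cong suc (freeCount-empty n)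

  T-is-nothing : ∀ {m : Maybe Val} → T (is-nothing m) → m ≡ nothing
  T-is-nothing {nothing} _ = refl

  ∈-moves : ∀ (a : Assignment n) {j} w → lookup a j ≡ nothing → (j , w) ∈ moves a
  ∈-moves a {j} w aj =
    ∈-concatMap⁺ _ (lose (∈-filter⁺ _ (∈-allFin j) (subst (T ∘ is-nothing) (sym aj) tt)) (both w))
    where
    both : ∀ w → (j , w) ∈ (j , plus) ∷ (j , minus) ∷ []
    both plus  = here refl
    both minus = there (here refl)

  moves⇒free : ∀ (a : Assignment n) {j w} → (j , w) ∈ moves a → lookup a j ≡ nothing
  moves⇒free {n} a m with find (∈-concatMap⁻ _ {xs = filter _ (allFin n)} m)
  ... | i , i∈ , here refl         = T-is-nothing (proj₂ (∈-filter⁻ _ {xs = allFin n} i∈))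
  ... | i , i∈ , there (here refl) = T-is-nothing (proj₂ (∈-filter⁻ _ {xs = allFin n} i∈))

  best-attains : ∀ X {c x xs} → Any (λ y → c ≤ favour X y) (x ∷ xs) → c ≤ favour X (best X x xs)
  best-attains P {xs = xs} attained =
    foldr-preservesᵒ (λ a b → [ i≤j⇒i≤j⊔k b , i≤j⇒i≤k⊔j a ]) _ xs (toSum attained)
  best-attains N {c} {xs = xs} attained =
    foldr-preservesᵒ (λ a b → subst (c ≤_) (sym (neg-distrib-⊓-⊔ a b)) ∘ [ i≤j⇒i≤j⊔k (- b) , i≤j⇒i≤k⊔j (- a) ])
      _ xs (toSum attained)

  best-guarded : ∀ X {c x xs} → All (λ y → c ≤ favour X y) (x ∷ xs) → c ≤ favour X (best (other X) x xs)
  best-guarded P {c} (cx ∷ cxs) = foldr-preservesᵇ {P = c ≤_} ⊓-glb cx cxs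
  best-guarded N {c} (cx ∷ cxs) =
    foldr-preservesᵇ {P = λ y → c ≤ - y} (λ {a} {b} ca cb → subst (c ≤_) (sym (neg-distrib-⊔-⊓ a b)) (⊓-glb ca cb))
                     cx cxs

  other-involutive : ∀ X → other (other X) ≡ X
  other-involutive P = refl
  other-involutive N = refl

  minimax-own-move : ∀ X f (G : Graph n) k (a : Assignment n) {j w c} → lookup a j ≡ nothing →
    c ≤ favour X (minimax f G k (other X) (a [ j ]≔ just w)) → c ≤ favour X (minimax f G (suc k) X a)
  minimax-own-move X f G k a {w = w} aj c≤ with moves a | ∈-moves a w aj
  ... | (i , v) ∷ ms | here refl = best-attains X (here c≤)
  ... | (i , v) ∷ ms | there m   = best-attains X (there (map⁺ (lose m c≤)))

  minimax-opponent-move : ∀ X f (G : Graph n) k (a : Assignment n) {i c} → lookup a i ≡ nothing →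
    (∀ {j} w → lookup a j ≡ nothing → c ≤ favour X (minimax f G k X (a [ j ]≔ just w))) →
    c ≤ favour X (minimax f G (suc k) (other X) a)
  minimax-opponent-move X f G k a {c = c} ai c≤ with moves a | ∈-moves a plus ai | moves⇒free a
  ... | (i , v) ∷ ms | _ | free = best-guarded X (c≤′ (here refl) ∷ All.map⁺ (All.tabulate (c≤′ ∘ there)))
    where
    c≤′ : ∀ {j w} → (j , w) ∈ (i , v) ∷ ms → c ≤ favour X (minimax f G k (other (other X)) (a [ j ]≔ just w))
    c≤′ {w = w} m = subst (λ r → c ≤ favour X (minimax f G k r _)) (sym (other-involutive X)) (c≤ w (free m))

  best-mono : ∀ {g} → Monotonic₁ _≤_ _≤_ g → ∀ r x xs → g (best r x xs) ≡ best r (g x) (map g xs)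
  best-mono g-mono P x []       = refl
  best-mono g-mono N x []       = refl
  best-mono g-mono P x (y ∷ ys) = trans (mono-≤-distrib-⊔ g-mono y _) (cong (_ ⊔_) (best-mono g-mono P x ys))
  best-mono g-mono N x (y ∷ ys) = trans (mono-≤-distrib-⊓ g-mono y _) (cong (_ ⊓_) (best-mono g-mono N x ys))

  minimax-∘ : ∀ {g} → Monotonic₁ _≤_ _≤_ g → ∀ f (G : Graph n) k r a →
              minimax (g ∘ f) G k r a ≡ g (minimax f G k r a)
  minimax-∘ g-mono f G zero    r a = refl
  minimax-∘ g-mono f G (suc k) r a with moves a
  ... | []           = refl
  ... | (i , v) ∷ ms =
    trans (cong₂ (best r) (minimax-∘ g-mono f G k (other r) _)
                          (trans (map-cong (λ (j , w) → minimax-∘ g-mono f G k (other r) (a [ j ]≔ just w)) ms)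
                                 (map-∘ ms)))
          (sym (best-mono g-mono r _ _))

  -- Connectedness, phrased as: every cut between assigned and free vertices is crossed by an edge.
  Connected : Graph n → Set
  Connected {n} G = ∀ (a : Assignment n) {i j x} → lookup a i ≡ just x → lookup a j ≡ nothing →
    ∃₂ λ p q → ∃ λ y → Adjacent G p q × lookup a p ≡ just y × lookup a q ≡ nothing

  module Greedy (X : Player) (G : Graph n) (connected : Connected G) where

    Assigned : Assignment n → Set
    Assigned a = ∃₂ λ i x → lookup a i ≡ just x

    terminal : ∀ a → bound X G a + + 0 ≤ favour X (score G a)
    terminal a = subst (_≤ favour X (score G a)) (sym (+-identityʳ _)) (bound≤favour-score X G a)

    secures-own-move : ∀ k a → freeCount a ≡ k → Assigned a →
                       bound X G a + + (⌈ k /2⌉ * 2) ≤ favour X (minimax id G k X a)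
    secures-opponent-move : ∀ k a → freeCount a ≡ k →
                            bound X G a + + (⌊ k /2⌋ * 2) ≤ favour X (minimax id G k (other X) a)

    secures-own-move zero a _ _ = terminal a
    secures-own-move (suc k) a fc (_ , _ , ai) with free-exists a fc
    ... | _ , aj with connected a ai aj
    ... | p , q , y , adj , ap , aq =
      minimax-own-move X id G k a aq (≤-trans gain (secures-opponent-move k _ (freeCount-move a _ aq fc)))
      where
      t : ℕ
      t = ⌊ k /2⌋ * 2

      gain : bound X G a + + (2 ℕ.+ t) ≤ bound X G (a [ q ]≔ just (reply X y)) + + t
      gain = ≤-trans (≤-reflexive (trans (cong (λ z → bound X G a + z) (pos-+ 2 t))
                                         (sym (+-assoc (bound X G a) (+ 2) (+ t)))))
                     (+-monoˡ-≤ (+ t) (reply-gain X G adj ap aq))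

    secures-opponent-move zero a _ = terminal a
    secures-opponent-move (suc k) a fc with free-exists a fc
    ... | _ , ai = minimax-opponent-move X id G k a ai λ {j} w aj →
      ≤-trans (+-monoˡ-≤ _ (bound-mono X G (⊑-update a w aj)))
              (secures-own-move k _ (freeCount-move a w aj fc) (j , w , lookup∘update j a (just w)))

  open Greedy

  -- The opening move has no assigned neighbour to answer, so it is the one move of X that gains nothing.
  first-mover-secures : ∀ X {m} (G : Graph (suc m)) → Connected G →
                        - + length G + + (⌊ m /2⌋ * 2) ≤ favour X (optimalScore G X)
  first-mover-secures X {m} G connected =
    minimax-own-move X id G m (empty (suc m)) {j = fzero} {w = plus} refl
      (≤-trans (+-monoˡ-≤ _ (≤-trans (≤-reflexive (sym (bound-empty X G)))
                                     (bound-mono X G (⊑-update (empty (suc m)) {fzero} plus refl))))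
               (secures-opponent-move X G connected m _ (freeCount-empty m)))

  second-mover-secures : ∀ F {m} (G : Graph (suc m)) → Connected G →
                         - + length G + + (⌈ m /2⌉ * 2) ≤ favour (other F) (optimalScore G F)
  second-mover-secures F {m} G connected =
    subst (λ r → - + length G + + (⌈ m /2⌉ * 2) ≤ favour (other F) (minimax id G (suc m) r (empty (suc m))))
          (other-involutive F)
          (≤-trans (≤-reflexive (cong (_+ + (⌈ m /2⌉ * 2)) (sym (bound-empty (other F) G))))
                   (secures-opponent-move (other F) G connected (suc m) (empty (suc m)) (freeCount-empty (suc m))))

  path-frontier : ∀ {m} (a : Assignment (suc m)) {i j x} → lookup a i ≡ just x → lookup a j ≡ nothing →
    ∃₂ λ (e : Fin m) y → (lookup a (inject₁ e) ≡ just y × lookup a (fsuc e) ≡ nothing)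
                       ⊎ (lookup a (fsuc e) ≡ just y × lookup a (inject₁ e) ≡ nothing)
  path-frontier (just x ∷ [])  {j = fzero} _  ()
  path-frontier (nothing ∷ []) {i = fzero} () _
  path-frontier (just y ∷ nothing ∷ a) _ _ = fzero , y , inj₁ (refl , refl)
  path-frontier (nothing ∷ just y ∷ a) _ _ = fzero , y , inj₂ (refl , refl)
  path-frontier (just x ∷ just y ∷ a) {j = fsuc j} _ aj with path-frontier (just y ∷ a) {i = fzero} {j} refl aj
  ... | e , z , frontier = fsuc e , z , frontier
  path-frontier (nothing ∷ nothing ∷ a) {i = fsuc i} ai _ with path-frontier (nothing ∷ a) {i} {fzero} ai refl
  ... | e , z , frontier = fsuc e , z , frontier

  path-connected : Connected (pathGraph n)
  path-connected {suc m} a ai aj with path-frontier a ai aj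
  ... | e , y , inj₁ (ap , aq) = inject₁ e , fsuc e , y , inj₁ (∈-map⁺ _ (∈-allFin e)) , ap , aq
  ... | e , y , inj₂ (ap , aq) = fsuc e , inject₁ e , y , inj₂ (∈-map⁺ _ (∈-allFin e)) , ap , aq

  length-pathGraph : ∀ m → length (pathGraph (suc m)) ≡ m
  length-pathGraph m = trans (length-map _ (allFin m)) (length-tabulate id)

  ≤-neg : ∀ {v s} → v ≤ - s → s ≤ - v
  ≤-neg {v} {s} v≤-s = subst (_≤ - v) (neg-involutive s) (neg-mono-≤ v≤-s)

  score-pinch : ∀ F {s v} → v ≤ favour (other F) s → - v ≤ favour F s → s ≡ favour (other F) v
  score-pinch P v≤-s -v≤s = ≤-antisym (≤-neg v≤-s) -v≤s
  score-pinch N {s} {v} v≤s -v≤-s = ≤-antisym (subst (s ≤_) (neg-involutive v) (≤-neg -v≤-s)) v≤s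

  path-optimalScore : ∀ m F {v} → - + m + + (⌊ m /2⌋ * 2) ≡ - v → - + m + + (⌈ m /2⌉ * 2) ≡ v →
                      optimalScore (pathGraph (suc m)) F ≡ favour (other F) v
  path-optimalScore m F first second =
    score-pinch F (subst (_≤ _) (trans (cong (λ l → - + l + + (⌈ m /2⌉ * 2)) (length-pathGraph m)) second)
                                (second-mover-secures F (pathGraph (suc m)) path-connected))
                  (subst (_≤ _) (trans (cong (λ l → - + l + + (⌊ m /2⌋ * 2)) (length-pathGraph m)) first)
                                (first-mover-secures F (pathGraph (suc m)) path-connected))

  sgn-mono : Monotonic₁ _≤_ _≤_ sgn
  sgn-mono (-≤- _) = ≤-refl
  sgn-mono { -[1+ _ ]} {+ zero}  -≤+ = -≤+
  sgn-mono { -[1+ _ ]} {+ suc _} -≤+ = -≤+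
  sgn-mono {+ zero}  {+ zero}  (+≤+ _) = ≤-refl
  sgn-mono {+ zero}  {+ suc _} (+≤+ _) = +≤+ z≤n
  sgn-mono {+ suc _} {+ suc _} (+≤+ _) = ≤-refl

  outcome-of-optimalScore : ∀ (G : Graph n) F {s} → optimalScore G F ≡ s → outcome G F ≡ toResult (sgn s)
  outcome-of-optimalScore {n} G F score≡s =
    trans (cong toResult (minimax-∘ sgn-mono id G n F (empty n))) (cong (toResult ∘ sgn) score≡s)

  wins-inFavourOf : ∀ X k → toResult (sgn (inFavourOf X (suc k))) ≡ wins X
  wins-inFavourOf P k = refl
  wins-inFavourOf N k = refl

  ⌊q*2/2⌋≡q : ∀ q → ⌊ q * 2 /2⌋ ≡ q
  ⌊q*2/2⌋≡q zero    = refl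
  ⌊q*2/2⌋≡q (suc q) = cong suc (⌊q*2/2⌋≡q q)

  ⌊1+q*2/2⌋≡q : ∀ q → ⌊ suc (q * 2) /2⌋ ≡ q
  ⌊1+q*2/2⌋≡q zero    = refl
  ⌊1+q*2/2⌋≡q (suc q) = cong suc (⌊1+q*2/2⌋≡q q)

  -[1+t]+t≡-1 : ∀ t → - + suc t + + t ≡ - + 1
  -[1+t]+t≡-1 zero    = refl
  -[1+t]+t≡-1 (suc t) = trans ([1+m]⊖[1+n]≡m⊖n t (suc t)) (-[1+t]+t≡-1 t)

  -[1+t]+[2+t]≡1 : ∀ t → - + suc t + + suc (suc t) ≡ + 1
  -[1+t]+[2+t]≡1 zero    = refl
  -[1+t]+[2+t]≡1 (suc t) = trans ([1+m]⊖[1+n]≡m⊖n (suc (suc t)) (suc t)) (-[1+t]+[2+t]≡1 t)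

  odd-form : ∀ n → n % 2 ≡ 1 → n ≡ suc (n / 2 * 2)
  odd-form n n%2≡1 = trans (m≡m%n+[m/n]*n n 2) (cong (λ r → r ℕ.+ n / 2 * 2) n%2≡1)

  even-form : ∀ n → 1 ℕ.≤ n → n % 2 ≡ 0 → ∃ λ q → n ≡ suc (suc (q * 2))
  even-form (suc n) _ n%2≡0
    with suc n / 2 | trans (m≡m%n+[m/n]*n (suc n) 2) (cong (λ r → r ℕ.+ suc n / 2 * 2) n%2≡0)
  ... | suc q | n≡ = q , n≡
  ... | zero  | ()

  path-odd : ∀ n → n % 2 ≡ 1 → ∀ F → (outcome (pathGraph n) F ≡ draw) × (optimalScore (pathGraph n) F ≡ + 0)
  path-odd n n%2≡1 F rewrite odd-form n n%2≡1 = outcome-of-optimalScore (pathGraph (suc t)) F score≡0 , score≡0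
    where
    q t : ℕ
    q = n / 2
    t = q * 2

    first : - + t + + (⌊ t /2⌋ * 2) ≡ - + 0
    first rewrite ⌊q*2/2⌋≡q q = +-inverseˡ (+ t)

    second : - + t + + (⌈ t /2⌉ * 2) ≡ + 0
    second rewrite ⌊1+q*2/2⌋≡q q = +-inverseˡ (+ t)

    score≡0 : optimalScore (pathGraph (suc t)) F ≡ + 0
    score≡0 = trans (path-optimalScore t F first second) (favour-0 (other F))

  path-even : ∀ n → 1 ℕ.≤ n → n % 2 ≡ 0 → ∀ F →
              (outcome (pathGraph n) F ≡ wins (other F)) × (optimalScore (pathGraph n) F ≡ inFavourOf (other F) 1)
  path-even n 1≤n n%2≡0 F with even-form n 1≤n n%2≡0
  ... | q , refl =
    trans (outcome-of-optimalScore (pathGraph (suc (suc t))) F score≡1) (wins-inFavourOf (other F) 0) , score≡1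
    where
    t : ℕ
    t = q * 2

    first : - + suc t + + (⌊ suc t /2⌋ * 2) ≡ - + 1
    first rewrite ⌊1+q*2/2⌋≡q q = -[1+t]+t≡-1 t

    second : - + suc t + + (⌈ suc t /2⌉ * 2) ≡ + 1
    second rewrite ⌊q*2/2⌋≡q q = -[1+t]+[2+t]≡1 t

    score≡1 : optimalScore (pathGraph (suc (suc t))) F ≡ inFavourOf (other F) 1
    score≡1 = trans (path-optimalScore (suc t) F first second) (favour-+1 (other F))

open SignGameOnGraphs using (path-odd; path-even)
open import Data.Nat using (ℕ; _≤_; _%_)

theorem5 : (n : ℕ) → 1 ≤ n → (first : Player) →
    ((n % 2 ≡ 1) → (outcome (pathGraph n) first ≡ draw) × (optimalScore (pathGraph n) first ≡ + 0))
    × ((n % 2 ≡ 0) → (outcome (pathGraph n) first ≡ wins (other first)) × (optimalScore (pathGraph n) first ≡ inFavourOf (other first) 1))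
theorem5 n 1≤n first = (λ n%2≡1 → path-odd n n%2≡1 first) , (λ n%2≡0 → path-even n 1≤n n%2≡0 first)
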